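{- Let $x$ be a real number. For every integer $n\ge 0$, $$x\sum_{k=0}^{n}(-1)^k\mathcal{B}_k(x)\binom{n}{k}(1-q)^{n-k}q^k=\sum_{j=0}^{n}(-1)^j\binom{n}{j}\mathcal{B}_{j+1}(x)q^j,$$ $$x\sum_{k=0}^{n}(-1)^k w_k(x)\binom{n}{k}(1-q)^{n-k}q^k=(x+1)\sum_{j=0}^{n}\binom{n}{j}w_j(x)(-q)^j-1 .$$
   Context: $\left\{ n \atop j\right\}$ denotes the Stirling number of the second kind (with $\left\{ 0 \atop 0\right\}=1$). The single-variable Bell polynomials are $\mathcal{B}_n(x)=\sum_{j=0}^{n}\left\{ n \atop j\right\}x^j$ and the geometric polynomials are $w_n(x)=\sum_{j=0}^{n}j!\left\{ n \atop j\right\}x^j$. -}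

module Defs where

open import Level using (Level)
open import Data.Nat using (ℕ; zero; suc) renaming (_+_ to _+ℕ_; _*_ to _*ℕ_)
open import Algebra.Bundles using (CommutativeRing)
open import Data.Nat using (_!)

stirling2 : ℕ → ℕ → ℕ
stirling2 zero    zero    = 1
stirling2 zero    (suc j) = 0
stirling2 (suc n) zero    = 0
stirling2 (suc n) (suc j) = suc j *ℕ stirling2 n (suc j) +ℕ stirling2 n j

module Poly {c ℓ : Level} (R : CommutativeRing c ℓ) where
  open CommutativeRing R hiding (zero)

  fromℕ : ℕ → Carrier
  fromℕ zero    = 0#
  fromℕ (suc n) = 1# + fromℕ n

  pow : Carrier → ℕ → Carrier
  pow x zero    = 1#
  pow x (suc n) = x * pow x n

  sumTo : ℕ → (ℕ → Carrier) → Carrier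
  sumTo zero    f = f zero
  sumTo (suc n) f = sumTo n f + f (suc n)

  bell : ℕ → Carrier → Carrier
  bell n x = sumTo n (λ j → fromℕ (stirling2 n j) * pow x j)

  -- geometric polynomial  w_n(x) = Σ_{j=0}^{n} j! {n \atop j} x^j
  geom : ℕ → Carrier → Carrier
  geom n x = sumTo n (λ j → fromℕ ((j !) *ℕ stirling2 n j) * pow x j)

{-# OPTIONS --safe #-}
module Submission where

open import Defs
open import Level using (Level)
open import Data.Nat using (ℕ; suc; _∸_)
open import Data.Nat.Combinatorics using (_C_)
open import Data.Product using (_×_)
open import Algebra.Bundles using (CommutativeRing)

open import Data.Nat using (zero; _≤_; _<_; _≤′_; ≤′-refl; ≤′-step; s≤s; z≤n; _!)
  renaming (_+_ to _+ℕ_; _*_ to _*ℕ_)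
import Data.Nat.Properties as ℕ
open import Data.Nat.Properties using (≤-refl; ≤⇒≤′; ≤′⇒≤; m≤n⇒m≤1+n; +-∸-assoc)
open import Data.Nat.Combinatorics using (nCk+nC[k+1]≡[n+1]C[k+1]; k>n⇒nCk≡0)
open import Data.Product using (_,_)
open import Function using (_∘_)
open import Relation.Binary.PropositionalEquality as ≡ using (_≡_; cong)

-- Both identities are Euler's transformation of the binomial transform
-- (T a)(j) = Σ_i C(j,i) a_i: for every p,
--   Σ_k C(n,k) p^k (1+p)^(n-k) a_k = Σ_j C(n,j) p^j (T a)(j),
-- taken at p = -q. It holds by induction on n, because by Pascal's rule each
-- side at n+1 equals the same side at n plus p times the same side at n
-- applied to i ↦ a_i + a_(i+1). After multiplying by x it remains to know
-- x (T B)(j) = B_(j+1)(x) and x (T w)(j) = (1+x) w_j(x) - [j = 0]; both follow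
-- from the Stirling identity S(n+1,k+1) = Σ_i C(n,i) S(i,k).

stirling2-above-diagonal : ∀ {k j} → k < j → stirling2 k j ≡ 0
stirling2-above-diagonal {zero}  {suc j} _ = ≡.refl
stirling2-above-diagonal {suc k} {suc j} (s≤s k<j)
  rewrite stirling2-above-diagonal k<j
        | stirling2-above-diagonal (m≤n⇒m≤1+n k<j) = cong (_+ℕ 0) (ℕ.*-zeroʳ j)

stirling2-suc-1 : ∀ n → stirling2 (suc n) 1 ≡ 1
stirling2-suc-1 zero    = ≡.refl
stirling2-suc-1 (suc n) = cong (λ s → s +ℕ 0 +ℕ 0) (stirling2-suc-1 n)

module _ {c ℓ : Level} (R : CommutativeRing c ℓ) where
  open CommutativeRing R hiding (zero)
  open Poly R
  open import Relation.Binary.Reasoning.Setoid setoid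
  open import Algebra.Solver.Ring.NaturalCoefficients.Default commutativeSemiring
  open import Algebra.Properties.Ring ring using (-1*x≈-x)
  open import Algebra.Properties.Group +-group using (x≈z//y)
  open import Algebra.Properties.Semiring.Mult semiring
    using (×-homo-+; ×1-homo-*) renaming (_×_ to _·_)

  sumTo-cong-≤ : ∀ n {f g : ℕ → Carrier} → (∀ i → i ≤ n → f i ≈ g i) → sumTo n f ≈ sumTo n g
  sumTo-cong-≤ zero    f≈g = f≈g 0 z≤n
  sumTo-cong-≤ (suc n) f≈g =
    +-cong (sumTo-cong-≤ n (λ i i≤n → f≈g i (m≤n⇒m≤1+n i≤n))) (f≈g (suc n) ≤-refl)

  sumTo-cong : ∀ n {f g : ℕ → Carrier} → (∀ i → f i ≈ g i) → sumTo n f ≈ sumTo n g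
  sumTo-cong n f≈g = sumTo-cong-≤ n (λ i _ → f≈g i)

  sumTo-+ : ∀ n (f g : ℕ → Carrier) → sumTo n (λ i → f i + g i) ≈ sumTo n f + sumTo n g
  sumTo-+ zero    f g = refl
  sumTo-+ (suc n) f g = begin
    sumTo n (λ i → f i + g i) + (f (suc n) + g (suc n))
      ≈⟨ +-congʳ (sumTo-+ n f g) ⟩
    (sumTo n f + sumTo n g) + (f (suc n) + g (suc n))
      ≈⟨ solve 4 (λ a b c d → (a :+ b) :+ (c :+ d) := (a :+ c) :+ (b :+ d)) refl _ _ _ _ ⟩
    sumTo (suc n) f + sumTo (suc n) g ∎

  *-distribˡ-sumTo : ∀ n a (f : ℕ → Carrier) → a * sumTo n f ≈ sumTo n (λ i → a * f i)
  *-distribˡ-sumTo zero    a f = refl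
  *-distribˡ-sumTo (suc n) a f = trans (distribˡ a _ _) (+-congʳ (*-distribˡ-sumTo n a f))

  sumTo-suc-head : ∀ n (f : ℕ → Carrier) → sumTo (suc n) f ≈ f 0 + sumTo n (f ∘ suc)
  sumTo-suc-head zero    f = refl
  sumTo-suc-head (suc n) f = trans (+-congʳ (sumTo-suc-head n f)) (+-assoc _ _ _)

  sumTo-vanishing-tail : ∀ {k n} (f : ℕ → Carrier) →
    (∀ i → k < i → f i ≈ 0#) → k ≤ n → sumTo n f ≈ sumTo k f
  sumTo-vanishing-tail {k} f tail≈0 k≤n = go (≤⇒≤′ k≤n)
    where
      go : ∀ {n} → k ≤′ n → sumTo n f ≈ sumTo k f
      go ≤′-refl = refl
      go {suc n} (≤′-step k≤′n) =
        trans (+-cong (go k≤′n) (tail≈0 (suc n) (s≤s (≤′⇒≤ k≤′n)))) (+-identityʳ _)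

  sumTo-swap : ∀ m n (f : ℕ → ℕ → Carrier) →
    sumTo m (λ i → sumTo n (f i)) ≈ sumTo n (λ j → sumTo m (λ i → f i j))
  sumTo-swap zero    n f = refl
  sumTo-swap (suc m) n f = trans (+-congʳ (sumTo-swap m n f))
    (sym (sumTo-+ n (λ j → sumTo m (λ i → f i j)) (f (suc m))))

  fromℕ≈·1# : ∀ n → fromℕ n ≈ n · 1#
  fromℕ≈·1# zero    = refl
  fromℕ≈·1# (suc n) = +-congˡ (fromℕ≈·1# n)

  fromℕ-+ : ∀ m n → fromℕ (m +ℕ n) ≈ fromℕ m + fromℕ n
  fromℕ-+ m n = begin
    fromℕ (m +ℕ n)  ≈⟨ fromℕ≈·1# (m +ℕ n) ⟩
    (m +ℕ n) · 1#   ≈⟨ ×-homo-+ 1# m n ⟩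
    m · 1# + n · 1# ≈⟨ sym (+-cong (fromℕ≈·1# m) (fromℕ≈·1# n)) ⟩
    fromℕ m + fromℕ n ∎

  fromℕ-* : ∀ m n → fromℕ (m *ℕ n) ≈ fromℕ m * fromℕ n
  fromℕ-* m n = begin
    fromℕ (m *ℕ n)      ≈⟨ fromℕ≈·1# (m *ℕ n) ⟩
    (m *ℕ n) · 1#       ≈⟨ ×1-homo-* m n ⟩
    (m · 1#) * (n · 1#) ≈⟨ sym (*-cong (fromℕ≈·1# m) (fromℕ≈·1# n)) ⟩
    fromℕ m * fromℕ n ∎

  pow-neg : ∀ q k → pow (- q) k ≈ pow (- 1#) k * pow q k
  pow-neg q zero    = sym (*-identityˡ 1#)
  pow-neg q (suc k) = trans (*-cong (sym (-1*x≈-x q)) (pow-neg q k))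
    (solve 4 (λ m q u v → (m :* q) :* (u :* v) := (m :* u) :* (q :* v)) refl (- 1#) q (pow (- 1#) k) (pow q k))

  fromℕ-C0 : ∀ n → fromℕ (n C 0) ≈ 1#
  fromℕ-C0 n = +-identityʳ 1#  -- n C 0 computes to 1

  binomialTransform : (ℕ → Carrier) → ℕ → Carrier
  binomialTransform a n = sumTo n (λ i → fromℕ (n C i) * a i)

  binomialTransform-cong-≤ : ∀ n {a b : ℕ → Carrier} →
    (∀ i → i ≤ n → a i ≈ b i) → binomialTransform a n ≈ binomialTransform b n
  binomialTransform-cong-≤ n a≈b = sumTo-cong-≤ n (λ i i≤n → *-congˡ (a≈b i i≤n))

  binomialTransform-cong : ∀ n {a b : ℕ → Carrier} →
    (∀ i → a i ≈ b i) → binomialTransform a n ≈ binomialTransform b n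
  binomialTransform-cong n a≈b = binomialTransform-cong-≤ n (λ i _ → a≈b i)

  binomialTransform-+ : ∀ n (a b : ℕ → Carrier) →
    binomialTransform (λ i → a i + b i) n ≈ binomialTransform a n + binomialTransform b n
  binomialTransform-+ n a b =
    trans (sumTo-cong n (λ i → distribˡ (fromℕ (n C i)) (a i) (b i))) (sumTo-+ n _ _)

  *-distribˡ-binomialTransform : ∀ n y (a : ℕ → Carrier) →
    y * binomialTransform a n ≈ binomialTransform (λ i → y * a i) n
  *-distribˡ-binomialTransform n y a = trans (*-distribˡ-sumTo n y _)
    (sumTo-cong n (λ i → solve 3 (λ y c a → y :* (c :* a) := c :* (y :* a)) refl y (fromℕ (n C i)) (a i)))

  binomialTransform-extend : ∀ n (a : ℕ → Carrier) →
    sumTo (suc n) (λ i → fromℕ (n C i) * a i) ≈ binomialTransform a n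
  binomialTransform-extend n a = begin
    binomialTransform a n + fromℕ (n C suc n) * a (suc n)
      ≈⟨ +-congˡ (*-congʳ (reflexive (cong fromℕ (k>n⇒nCk≡0 {n} ≤-refl)))) ⟩
    binomialTransform a n + 0# * a (suc n)
      ≈⟨ +-congˡ (zeroˡ _) ⟩
    binomialTransform a n + 0#
      ≈⟨ +-identityʳ _ ⟩
    binomialTransform a n ∎

  fromℕ-pascal : ∀ n i → fromℕ (suc n C suc i) ≈ fromℕ (n C i) + fromℕ (n C suc i)
  fromℕ-pascal n i =
    trans (reflexive (cong fromℕ (≡.sym (nCk+nC[k+1]≡[n+1]C[k+1] n i)))) (fromℕ-+ (n C i) (n C suc i))

  binomialTransform-suc : ∀ n (a : ℕ → Carrier) →
    binomialTransform a (suc n) ≈ binomialTransform a n + binomialTransform (a ∘ suc) n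
  binomialTransform-suc n a = begin
    binomialTransform a (suc n)
      ≈⟨ sumTo-suc-head n _ ⟩
    fromℕ (n C 0) * a 0 + sumTo n (λ i → fromℕ (suc n C suc i) * a (suc i))
      ≈⟨ +-congˡ (sumTo-cong n (λ i → *-congʳ (fromℕ-pascal n i))) ⟩
    fromℕ (n C 0) * a 0 + sumTo n (λ i → (fromℕ (n C i) + fromℕ (n C suc i)) * a (suc i))
      ≈⟨ +-congˡ (trans (sumTo-cong n (λ i → distribʳ (a (suc i)) _ _)) (sumTo-+ n _ _)) ⟩
    fromℕ (n C 0) * a 0 + (binomialTransform (a ∘ suc) n + upper)
      ≈⟨ solve 3 (λ h s t → h :+ (s :+ t) := (h :+ t) :+ s) refl _ _ upper ⟩
    (fromℕ (n C 0) * a 0 + upper) + binomialTransform (a ∘ suc) n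
      ≈⟨ +-congʳ (sym (sumTo-suc-head n _)) ⟩
    sumTo (suc n) (λ i → fromℕ (n C i) * a i) + binomialTransform (a ∘ suc) n
      ≈⟨ +-congʳ (binomialTransform-extend n a) ⟩
    binomialTransform a n + binomialTransform (a ∘ suc) n ∎
    where upper = sumTo n (λ i → fromℕ (n C suc i) * a (suc i))

  shiftSum : (ℕ → Carrier) → ℕ → Carrier
  shiftSum a i = a i + a (suc i)

  binomialTransform-suc-shiftSum : ∀ n (a : ℕ → Carrier) →
    binomialTransform a (suc n) ≈ binomialTransform (shiftSum a) n
  binomialTransform-suc-shiftSum n a =
    trans (binomialTransform-suc n a) (sym (binomialTransform-+ n a (a ∘ suc)))

  module EulerTransform (p : Carrier) where
    lhs : ℕ → (ℕ → Carrier) → Carrier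
    lhs n a = binomialTransform (λ i → pow p i * (pow (1# + p) (n ∸ i) * a i)) n

    rhs : ℕ → (ℕ → Carrier) → Carrier
    rhs n a = binomialTransform (λ j → pow p j * binomialTransform a j) n

    lhs-suc : ∀ n a → lhs (suc n) a ≈ (1# + p) * lhs n a + p * lhs n (a ∘ suc)
    lhs-suc n a = trans (binomialTransform-suc n _) (+-cong
      (trans (binomialTransform-cong-≤ n peelFactor) (sym (*-distribˡ-binomialTransform n (1# + p) _)))
      (trans (binomialTransform-cong n (λ i → *-assoc p _ _)) (sym (*-distribˡ-binomialTransform n p _))))
      where
        peelFactor : ∀ i → i ≤ n → pow p i * (pow (1# + p) (suc n ∸ i) * a i)
                                 ≈ (1# + p) * (pow p i * (pow (1# + p) (n ∸ i) * a i))
        peelFactor i i≤n rewrite +-∸-assoc 1 i≤n =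
          solve 4 (λ r u v w → u :* ((r :* v) :* w) := r :* (u :* (v :* w))) refl
            (1# + p) (pow p i) (pow (1# + p) (n ∸ i)) (a i)

    lhs-shiftSum : ∀ n a → lhs n (shiftSum a) ≈ lhs n a + lhs n (a ∘ suc)
    lhs-shiftSum n a = trans
      (binomialTransform-cong n (λ i → trans (*-congˡ (distribˡ _ _ _)) (distribˡ _ _ _)))
      (binomialTransform-+ n _ _)

    rhs-suc : ∀ n a → rhs (suc n) a ≈ rhs n a + p * rhs n (shiftSum a)
    rhs-suc n a = trans (binomialTransform-suc n _) (+-congˡ
      (trans (binomialTransform-cong n peelFactor) (sym (*-distribˡ-binomialTransform n p _))))
      where
        peelFactor : ∀ j → pow p (suc j) * binomialTransform a (suc j)
                   ≈ p * (pow p j * binomialTransform (shiftSum a) j)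
        peelFactor j = trans (*-assoc p _ _) (*-congˡ (*-congˡ (binomialTransform-suc-shiftSum j a)))

    lhs≈rhs : ∀ n a → lhs n a ≈ rhs n a
    lhs≈rhs zero    a = *-congˡ (*-congˡ (trans (*-identityˡ (a 0))
                          (sym (trans (*-congʳ (fromℕ-C0 0)) (*-identityˡ (a 0))))))
    lhs≈rhs (suc n) a = begin
      lhs (suc n) a
        ≈⟨ lhs-suc n a ⟩
      (1# + p) * lhs n a + p * lhs n (a ∘ suc)
        ≈⟨ solve 3 (λ p u v → (con 1 :+ p) :* u :+ p :* v := u :+ p :* (u :+ v)) refl p _ _ ⟩
      lhs n a + p * (lhs n a + lhs n (a ∘ suc))
        ≈⟨ +-congˡ (*-congˡ (sym (lhs-shiftSum n a))) ⟩
      lhs n a + p * lhs n (shiftSum a)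
        ≈⟨ +-cong (lhs≈rhs n a) (*-congˡ (lhs≈rhs n (shiftSum a))) ⟩
      rhs n a + p * rhs n (shiftSum a)
        ≈⟨ sym (rhs-suc n a) ⟩
      rhs (suc n) a ∎

  fromℕ-stirling2-suc-suc : ∀ n k → fromℕ (stirling2 (suc n) (suc k))
    ≈ fromℕ (suc k) * fromℕ (stirling2 n (suc k)) + fromℕ (stirling2 n k)
  fromℕ-stirling2-suc-suc n k =
    trans (fromℕ-+ (suc k *ℕ stirling2 n (suc k)) _) (+-congʳ (fromℕ-* (suc k) (stirling2 n (suc k))))

  binomialTransform-stirling2-0 : ∀ n (y : ℕ → Carrier) →
    binomialTransform (λ j → y j * fromℕ (stirling2 j 0)) n ≈ y 0
  binomialTransform-stirling2-0 n y = begin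
    binomialTransform (λ j → y j * fromℕ (stirling2 j 0)) n
      ≈⟨ sumTo-vanishing-tail {n = n} _ vanish z≤n ⟩
    fromℕ (n C 0) * (y 0 * fromℕ 1)
      ≈⟨ *-cong (fromℕ-C0 n) (*-congˡ (+-identityʳ 1#)) ⟩
    1# * (y 0 * 1#)
      ≈⟨ trans (*-identityˡ _) (*-identityʳ _) ⟩
    y 0 ∎
    where
      vanish : ∀ i → 0 < i → fromℕ (n C i) * (y i * fromℕ (stirling2 i 0)) ≈ 0#
      vanish (suc i) _ = trans (*-congˡ (zeroʳ (y (suc i)))) (zeroʳ _)

  binomialTransform-stirling2 : ∀ n k →
    binomialTransform (λ i → fromℕ (stirling2 i k)) n ≈ fromℕ (stirling2 (suc n) (suc k))
  binomialTransform-stirling2 n zero = begin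
    binomialTransform (λ i → fromℕ (stirling2 i 0)) n
      ≈⟨ binomialTransform-cong n (λ i → sym (*-identityˡ _)) ⟩
    binomialTransform (λ i → 1# * fromℕ (stirling2 i 0)) n
      ≈⟨ binomialTransform-stirling2-0 n (λ _ → 1#) ⟩
    1#
      ≈⟨ sym (+-identityʳ 1#) ⟩
    fromℕ 1
      ≈⟨ reflexive (cong fromℕ (≡.sym (stirling2-suc-1 n))) ⟩
    fromℕ (stirling2 (suc n) 1) ∎
  binomialTransform-stirling2 zero (suc k) =
    trans (zeroʳ _) (reflexive (cong fromℕ (≡.sym (stirling2-above-diagonal {1} {suc (suc k)} (s≤s (s≤s z≤n))))))
  binomialTransform-stirling2 (suc n) (suc k) = begin
    binomialTransform (λ i → fromℕ (stirling2 i (suc k))) (suc n)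
      ≈⟨ binomialTransform-suc n _ ⟩
    T n (suc k) + binomialTransform (λ i → fromℕ (stirling2 (suc i) (suc k))) n
      ≈⟨ +-congˡ (binomialTransform-cong n (λ i → fromℕ-stirling2-suc-suc i k)) ⟩
    T n (suc k) + binomialTransform (λ i → K * fromℕ (stirling2 i (suc k)) + fromℕ (stirling2 i k)) n
      ≈⟨ +-congˡ (trans (binomialTransform-+ n _ _) (+-congʳ (sym (*-distribˡ-binomialTransform n K _)))) ⟩
    T n (suc k) + (K * T n (suc k) + T n k)
      ≈⟨ +-cong IH (+-cong (*-congˡ IH) (binomialTransform-stirling2 n k)) ⟩
    S₁ + (K * S₁ + S₀)
      ≈⟨ solve 3 (λ s k t → s :+ (k :* s :+ t) := (con 1 :+ k) :* s :+ t) refl S₁ K S₀ ⟩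
    fromℕ (suc (suc k)) * S₁ + S₀
      ≈⟨ sym (fromℕ-stirling2-suc-suc (suc n) (suc k)) ⟩
    fromℕ (stirling2 (suc (suc n)) (suc (suc k))) ∎
    where
      T : ℕ → ℕ → Carrier
      T m l = binomialTransform (λ i → fromℕ (stirling2 i l)) m
      K = fromℕ (suc k)
      S₁ = fromℕ (stirling2 (suc n) (suc (suc k)))
      S₀ = fromℕ (stirling2 (suc n) (suc k))
      IH = binomialTransform-stirling2 n (suc k)

  module _ (x : Carrier) where
    -- c_j = 1 gives B_k(x) and c_j = j! gives w_k(x).
    stirlingPoly : (ℕ → Carrier) → ℕ → Carrier
    stirlingPoly c k = sumTo k (λ j → c j * (fromℕ (stirling2 k j) * pow x j))

    x*binomialTransform-stirlingPoly : ∀ c n →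
      x * binomialTransform (stirlingPoly c) n
        ≈ sumTo n (λ j → c j * (fromℕ (stirling2 (suc n) (suc j)) * pow x (suc j)))
    x*binomialTransform-stirlingPoly c n = begin
      x * binomialTransform (stirlingPoly c) n
        ≈⟨ *-congˡ (binomialTransform-cong-≤ n (λ k k≤n → sym (sumTo-vanishing-tail (t k) (vanish k) k≤n))) ⟩
      x * sumTo n (λ k → fromℕ (n C k) * sumTo n (t k))
        ≈⟨ *-congˡ (sumTo-cong n (λ k → *-distribˡ-sumTo n _ (t k))) ⟩
      x * sumTo n (λ k → sumTo n (λ j → fromℕ (n C k) * t k j))
        ≈⟨ *-congˡ (sumTo-swap n n _) ⟩
      x * sumTo n (λ j → binomialTransform (λ k → t k j) n)
        ≈⟨ *-congˡ (sumTo-cong n column) ⟩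
      x * sumTo n (λ j → (c j * pow x j) * fromℕ (stirling2 (suc n) (suc j)))
        ≈⟨ *-distribˡ-sumTo n x _ ⟩
      sumTo n (λ j → x * ((c j * pow x j) * fromℕ (stirling2 (suc n) (suc j))))
        ≈⟨ sumTo-cong n (λ j → solve 4 (λ x c p s → x :* ((c :* p) :* s) := c :* (s :* (x :* p))) refl
                                  x (c j) (pow x j) (fromℕ (stirling2 (suc n) (suc j)))) ⟩
      sumTo n (λ j → c j * (fromℕ (stirling2 (suc n) (suc j)) * pow x (suc j))) ∎
      where
        t : ℕ → ℕ → Carrier
        t k j = c j * (fromℕ (stirling2 k j) * pow x j)

        vanish : ∀ k j → k < j → t k j ≈ 0#
        vanish k j k<j = begin
          c j * (fromℕ (stirling2 k j) * pow x j)
            ≈⟨ *-congˡ (*-congʳ (reflexive (cong fromℕ (stirling2-above-diagonal k<j)))) ⟩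
          c j * (0# * pow x j)
            ≈⟨ trans (*-congˡ (zeroˡ _)) (zeroʳ _) ⟩
          0# ∎

        column : ∀ j → binomialTransform (λ k → t k j) n
                         ≈ (c j * pow x j) * fromℕ (stirling2 (suc n) (suc j))
        column j = begin
          binomialTransform (λ k → t k j) n
            ≈⟨ binomialTransform-cong n (λ k → solve 3 (λ c s p → c :* (s :* p) := (c :* p) :* s) refl
                                                  (c j) (fromℕ (stirling2 k j)) (pow x j)) ⟩
          binomialTransform (λ k → (c j * pow x j) * fromℕ (stirling2 k j)) n
            ≈⟨ sym (*-distribˡ-binomialTransform n _ _) ⟩
          (c j * pow x j) * binomialTransform (λ k → fromℕ (stirling2 k j)) n
            ≈⟨ *-congˡ (binomialTransform-stirling2 n j) ⟩
          (c j * pow x j) * fromℕ (stirling2 (suc n) (suc j)) ∎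

    x*binomialTransform-bell : ∀ n → x * binomialTransform (λ k → bell k x) n ≈ bell (suc n) x
    x*binomialTransform-bell n = begin
      x * binomialTransform (λ k → bell k x) n
        ≈⟨ *-congˡ (binomialTransform-cong n (λ k → sumTo-cong k (λ j → sym (*-identityˡ _)))) ⟩
      x * binomialTransform (stirlingPoly (λ _ → 1#)) n
        ≈⟨ x*binomialTransform-stirlingPoly _ n ⟩
      sumTo n (λ j → 1# * (fromℕ (stirling2 (suc n) (suc j)) * pow x (suc j)))
        ≈⟨ sumTo-cong n (λ j → *-identityˡ _) ⟩
      sumTo n (λ j → fromℕ (stirling2 (suc n) (suc j)) * pow x (suc j))
        ≈⟨ sym (trans (+-congʳ (zeroˡ 1#)) (+-identityˡ _)) ⟩
      fromℕ (stirling2 (suc n) 0) * pow x 0 + sumTo n (λ j → fromℕ (stirling2 (suc n) (suc j)) * pow x (suc j))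
        ≈⟨ sym (sumTo-suc-head n _) ⟩
      bell (suc n) x ∎

    geomTerm : ℕ → ℕ → Carrier
    geomTerm n j = fromℕ (j ! *ℕ stirling2 n j) * pow x j

    geomTerm-above-diagonal : ∀ n j → n < j → geomTerm n j ≈ 0#
    geomTerm-above-diagonal n j n<j = trans (*-congʳ (reflexive (cong fromℕ (≡.trans
      (cong (j ! *ℕ_) (stirling2-above-diagonal n<j)) (ℕ.*-zeroʳ (j !)))))) (zeroˡ _)

    factorial*stirling2-suc-suc : ∀ n j →
      fromℕ (j !) * (fromℕ (stirling2 (suc n) (suc j)) * pow x (suc j))
        ≈ geomTerm n (suc j) + x * geomTerm n j
    factorial*stirling2-suc-suc n j = begin
      F * (fromℕ (stirling2 (suc n) (suc j)) * (x * P))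
        ≈⟨ *-congˡ (*-congʳ (fromℕ-stirling2-suc-suc n j)) ⟩
      F * ((J * S₁ + S₀) * (x * P))
        ≈⟨ solve 6 (λ f j s₁ s₀ x p → f :* ((j :* s₁ :+ s₀) :* (x :* p))
                                   := (j :* f) :* s₁ :* (x :* p) :+ x :* (f :* s₀ :* p)) refl F J S₁ S₀ x P ⟩
      (J * F) * S₁ * (x * P) + x * (F * S₀ * P)
        ≈⟨ sym (+-cong (*-congʳ (trans (fromℕ-* (suc j !) (stirling2 n (suc j))) (*-congʳ (fromℕ-* (suc j) (j !)))))
                       (*-congˡ (*-congʳ (fromℕ-* (j !) (stirling2 n j))))) ⟩
      geomTerm n (suc j) + x * geomTerm n j ∎
      where
        F = fromℕ (j !)
        J = fromℕ (suc j)
        P = pow x j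
        S₁ = fromℕ (stirling2 n (suc j))
        S₀ = fromℕ (stirling2 n j)

    x*binomialTransform-geom : ∀ n →
      x * binomialTransform (λ k → geom k x) n + fromℕ (stirling2 n 0) ≈ (1# + x) * geom n x
    x*binomialTransform-geom n = begin
      x * binomialTransform (λ k → geom k x) n + δ
        ≈⟨ +-congʳ (*-congˡ (binomialTransform-cong n (λ k → sumTo-cong k (λ j →
             trans (*-congʳ (fromℕ-* (j !) (stirling2 k j))) (*-assoc _ _ _))))) ⟩
      x * binomialTransform (stirlingPoly (fromℕ ∘ _!)) n + δ
        ≈⟨ +-congʳ (x*binomialTransform-stirlingPoly _ n) ⟩
      sumTo n (λ j → fromℕ (j !) * (fromℕ (stirling2 (suc n) (suc j)) * pow x (suc j))) + δ
        ≈⟨ +-congʳ (sumTo-cong n (factorial*stirling2-suc-suc n)) ⟩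
      sumTo n (λ j → g (suc j) + x * g j) + δ
        ≈⟨ +-congʳ (trans (sumTo-+ n _ _) (+-congˡ (sym (*-distribˡ-sumTo n x g)))) ⟩
      (sumTo n (g ∘ suc) + x * geom n x) + δ
        ≈⟨ solve 3 (λ s w d → (s :+ w) :+ d := (d :+ s) :+ w) refl _ _ δ ⟩
      (δ + sumTo n (g ∘ suc)) + x * geom n x
        ≈⟨ +-congʳ (+-congʳ (sym g0≈δ)) ⟩
      (g 0 + sumTo n (g ∘ suc)) + x * geom n x
        ≈⟨ +-congʳ (sym (sumTo-suc-head n g)) ⟩
      sumTo (suc n) g + x * geom n x
        ≈⟨ +-congʳ (sumTo-vanishing-tail g (geomTerm-above-diagonal n) (ℕ.n≤1+n n)) ⟩
      geom n x + x * geom n x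
        ≈⟨ solve 2 (λ w x → w :+ x :* w := (con 1 :+ x) :* w) refl (geom n x) x ⟩
      (1# + x) * geom n x ∎
      where
        δ = fromℕ (stirling2 n 0)
        g = geomTerm n

        g0≈δ : g 0 ≈ δ
        g0≈δ = trans (*-identityʳ _) (reflexive (cong fromℕ (ℕ.*-identityˡ (stirling2 n 0))))

  module _ (x q : Carrier) (n : ℕ) where
    open EulerTransform (- q)  -- its 1# + - q is 1# - q by definition of _-_

    x*alternatingSum : ∀ a →
      x * sumTo n (λ k → pow (- 1#) k * a k * fromℕ (n C k) * pow (1# - q) (n ∸ k) * pow q k)
        ≈ binomialTransform (λ j → pow (- q) j * (x * binomialTransform a j)) n
    x*alternatingSum a = begin
      x * sumTo n (λ k → pow (- 1#) k * a k * fromℕ (n C k) * pow (1# - q) (n ∸ k) * pow q k)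
        ≈⟨ *-congˡ (sumTo-cong n regroup) ⟩
      x * lhs n a
        ≈⟨ *-congˡ (lhs≈rhs n a) ⟩
      x * rhs n a
        ≈⟨ *-distribˡ-binomialTransform n x _ ⟩
      binomialTransform (λ j → x * (pow (- q) j * binomialTransform a j)) n
        ≈⟨ binomialTransform-cong n (λ j → solve 3 (λ x p t → x :* (p :* t) := p :* (x :* t)) refl
                                              x (pow (- q) j) (binomialTransform a j)) ⟩
      binomialTransform (λ j → pow (- q) j * (x * binomialTransform a j)) n ∎
      where
        regroup : ∀ k → pow (- 1#) k * a k * fromℕ (n C k) * pow (1# - q) (n ∸ k) * pow q k
                          ≈ fromℕ (n C k) * (pow (- q) k * (pow (1# - q) (n ∸ k) * a k))
        regroup k = trans
          (solve 5 (λ m b c r u → m :* b :* c :* r :* u := c :* ((m :* u) :* (r :* b))) refl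
            (pow (- 1#) k) (a k) (fromℕ (n C k)) (pow (1# - q) (n ∸ k)) (pow q k))
          (*-congˡ (*-congʳ (sym (pow-neg q k))))

    alternatingSum-bell :
      x * sumTo n (λ k → pow (- 1#) k * bell k x * fromℕ (n C k) * pow (1# - q) (n ∸ k) * pow q k)
        ≈ sumTo n (λ j → pow (- 1#) j * fromℕ (n C j) * bell (suc j) x * pow q j)
    alternatingSum-bell = trans (x*alternatingSum (λ k → bell k x)) (sumTo-cong n (λ j →
      trans (*-congˡ (*-cong (pow-neg q j) (x*binomialTransform-bell x j)))
            (solve 4 (λ c m u b → c :* ((m :* u) :* b) := m :* c :* b :* u) refl
              (fromℕ (n C j)) (pow (- 1#) j) (pow q j) (bell (suc j) x))))

    alternatingSum-geom :
      x * sumTo n (λ k → pow (- 1#) k * geom k x * fromℕ (n C k) * pow (1# - q) (n ∸ k) * pow q k)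
        ≈ (x + 1#) * sumTo n (λ j → fromℕ (n C j) * geom j x * pow (- q) j) - 1#
    alternatingSum-geom = x≈z//y _ 1# _ (begin
      x * sumTo n (λ k → pow (- 1#) k * geom k x * fromℕ (n C k) * pow (1# - q) (n ∸ k) * pow q k) + 1#
        ≈⟨ +-cong (x*alternatingSum (λ k → geom k x)) (sym (binomialTransform-stirling2-0 n (pow (- q)))) ⟩
      binomialTransform (λ j → pow (- q) j * (x * binomialTransform (λ k → geom k x) j)) n
        + binomialTransform (λ j → pow (- q) j * fromℕ (stirling2 j 0)) n
        ≈⟨ sym (binomialTransform-+ n _ _) ⟩
      binomialTransform (λ j → pow (- q) j * (x * binomialTransform (λ k → geom k x) j)
                                 + pow (- q) j * fromℕ (stirling2 j 0)) n
        ≈⟨ binomialTransform-cong n (λ j →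
             trans (sym (distribˡ _ _ _)) (*-congˡ (x*binomialTransform-geom x j))) ⟩
      binomialTransform (λ j → pow (- q) j * ((1# + x) * geom j x)) n
        ≈⟨ sumTo-cong n (λ j → solve 4 (λ c p x w → c :* (p :* ((con 1 :+ x) :* w)) := (x :+ con 1) :* (c :* w :* p))
                                   refl (fromℕ (n C j)) (pow (- q) j) x (geom j x)) ⟩
      sumTo n (λ j → (x + 1#) * (fromℕ (n C j) * geom j x * pow (- q) j))
        ≈⟨ sym (*-distribˡ-sumTo n (x + 1#) _) ⟩
      (x + 1#) * sumTo n (λ j → fromℕ (n C j) * geom j x * pow (- q) j) ∎)

mainTheorem4 : {c ℓ : Level} (R : CommutativeRing c ℓ) →
    let open CommutativeRing R in let open Poly R in
    (x q : Carrier) (n : ℕ) →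
      (x * sumTo n (λ k → pow (- 1#) k * bell k x * fromℕ (n C k) * pow (1# - q) (n ∸ k) * pow q k)
        ≈ sumTo n (λ j → pow (- 1#) j * fromℕ (n C j) * bell (suc j) x * pow q j))
      ×
      (x * sumTo n (λ k → pow (- 1#) k * geom k x * fromℕ (n C k) * pow (1# - q) (n ∸ k) * pow q k)
        ≈ (x + 1#) * sumTo n (λ j → fromℕ (n C j) * geom j x * pow (- q) j) - 1#)
mainTheorem4 R x q n = alternatingSum-bell R x q n , alternatingSum-geom R x q n
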